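{- Let $n\ge 1$ and let $\mathcal F$ be a finite multi-family of subsets of $[n]$. Then $\mathcal F$ solves the problem $P_n(?\rightarrow 1)$ in the case where at most one answer can be wrong if and only if the following two conditions hold: (i) every element of $[n]$ is contained in at least $3$ members of $\mathcal F$ (counted with multiplicity); (ii) for every partition of the multi-family $\mathcal F$ into two sub-multi-families $\mathcal F_1,\mathcal F_2$ with $|\mathcal F_1|\ge 2$, if the family $$T^{*}(\mathcal F_1,\mathcal F_2)=\{T\subseteq[n]:\ T\cap F\neq\emptyset \text{ for } F\in\mathcal F_1 \text{ and } T\cap G=\emptyset \text{ for } G\in\mathcal F_2, \text{ with at most one exception among all members of }\mathcal F_1\cup\mathcal F_2\}$$ is non-empty, then $\bigcap_{T\in T^{*}(\mathcal F_1,\mathcal F_2)}T\neq\emptyset$.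
   Context: Problem $P_n(?\rightarrow 1)$ with at most one lie: an unknown set $T\subseteq[n]$ of "excellent" elements is given (possibly empty, size unknown). A non-adaptive algorithm is a finite multi-family $\mathcal F$ of subsets of $[n]$ (a set may occur several times; $|\mathcal F|$ counts multiplicity). For each member $F$ (each copy separately) the question "is $F\cap T\neq\emptyset$?" is asked and answered YES or NO; all answers are correct with at most one exception. Given an answer sequence, $T\subseteq[n]$ is consistent if at most one member's answer differs from the truth value of "$F\cap T\neq\emptyset$". $\mathcal F$ solves the problem if for every answer sequence, either some $x\in[n]$ lies in every consistent $T$, or every consistent $T$ is empty. A partition of a multi-family into two sub-multi-families may split the copies of a repeated set between the two parts. In (ii), "with at most one exception" means that at most one member (counted with multiplicity) of $\mathcal F_1\cup\mathcal F_2$ fails its required condition. -}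

module Defs where

open import Data.Nat using (ℕ; zero; suc; _≤_)
open import Data.Bool using (Bool; true; false; if_then_else_)
open import Data.Fin using (Fin; zero; suc)
open import Data.Fin.Subset using (Subset; _∈_; _∉_)
open import Data.Vec using (lookup)
open import Data.Product using (∃; _×_)
open import Data.Sum using (_⊎_)
open import Relation.Nullary using (¬_)
open import Relation.Binary.PropositionalEquality using (_≡_)

-- A finite multi-family of m subsets of [n], indexed by its members
-- (copies of a repeated set are distinct indices).
Family : ℕ → ℕ → Set
Family m n = Fin m → Subset n

count : ∀ {m} → (Fin m → Bool) → ℕ
count {zero}  b = 0
count {suc m} b = (if b zero then 1 else 0) Data.Nat.+ count (λ i → b (suc i))

Meets : ∀ {n} → Subset n → Subset n → Set
Meets F T = ∃ λ x → x ∈ F × x ∈ T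

AtMostOneException : ∀ {m} → (Fin m → Set) → Set
AtMostOneException {m} P = ∀ (i j : Fin m) → ¬ P i → ¬ P j → i ≡ j

AnswerCorrect : ∀ {m n} → Family m n → (Fin m → Bool) → Subset n → Fin m → Set
AnswerCorrect F a T i = (a i ≡ true → Meets (F i) T) × (Meets (F i) T → a i ≡ true)

Consistent : ∀ {m n} → Family m n → (Fin m → Bool) → Subset n → Set
Consistent F a T = AtMostOneException (AnswerCorrect F a T)

IsEmpty : ∀ {n} → Subset n → Set
IsEmpty T = ∀ x → x ∉ T

Solves : ∀ {m n} → Family m n → Set
Solves {m} {n} F = (a : Fin m → Bool) →
  (∃ λ (x : Fin n) → ∀ T → Consistent F a T → x ∈ T)
  ⊎ (∀ T → Consistent F a T → IsEmpty T)

CondI : ∀ {m n} → Family m n → Set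
CondI {m} {n} F = ∀ (x : Fin n) → 3 ≤ count (λ i → lookup (F i) x)

-- A partition of F into F₁, F₂ is p : Fin m → Bool (p i ≡ true iff member i ∈ F₁).
-- Required condition on member i: meets T if in F₁, disjoint from T if in F₂.
Required : ∀ {m n} → Family m n → (Fin m → Bool) → Subset n → Fin m → Set
Required F p T i = if p i then Meets (F i) T else ¬ Meets (F i) T

InTStar : ∀ {m n} → Family m n → (Fin m → Bool) → Subset n → Set
InTStar F p T = AtMostOneException (Required F p T)

CondII : ∀ {m n} → Family m n → Set
CondII {m} {n} F = ∀ (p : Fin m → Bool) → 2 ≤ count p →
  (∃ λ T → InTStar F p T) →
  ∃ λ (x : Fin n) → ∀ T → InTStar F p T → x ∈ T

-- Write an answer sequence a and the true answers t for a candidate set T as Boolean vectors;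
-- then T is consistent with a exactly when a and t differ in at most one coordinate, and such
-- a change moves the number of YES entries by at most one. If x lies in at most two members,
-- a sequence with at most one YES is one lie away from both ∅ and {x}, so no element is forced
-- and yet a nonempty set is consistent. Conversely, under (i) an element of a consistent T
-- lies in at least three members, which all meet T, so the sequence must contain at least two
-- YES answers; then every consistent T lies in T*(F₁, F₂) for the YES/NO partition, and (ii)
-- supplies the common element.

module Submission where

open import Defs
open import Data.Nat using (ℕ; _≤_)
open import Data.Product using (_×_)
open import Function.Bundles using (_⇔_)

open import Data.Bool using (Bool; true; false; if_then_else_)
open import Data.Bool.Properties using (¬-not) renaming (_≟_ to _≟ᵇ_)
open import Data.Empty using () renaming (⊥ to Empty)
open import Data.Fin using (Fin; zero; suc)
open import Data.Fin.Properties using (_≟_; any?; all?)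
open import Data.Fin.Subset using (Subset; _∈_; ⊥; ⁅_⁆)
open import Data.Fin.Subset.Properties using (_∈?_; ∉⊥; x∈⁅x⁆; x∈⁅y⁆⇒x≡y; anySubset?)
open import Data.Nat as ℕ using (suc; _+_; z≤n; s≤s)
open import Data.Nat.Properties
  using (≤-refl; ≤-trans; ≤-pred; ≤⇒≯; ≰⇒>; +-mono-≤; +-monoˡ-≤; n≤1+n; _≤?_; module ≤-Reasoning; +-commutativeSemigroup)
open import Algebra.Properties.CommutativeSemigroup +-commutativeSemigroup using (x∙yz≈y∙xz)
open import Data.Product using (∃; _,_; uncurry)
open import Data.Sum using (inj₁; inj₂)
open import Data.Vec using (lookup)
open import Data.Vec.Properties using ([]=⇒lookup; lookup⇒[]=)
open import Function using (_∘_)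
open import Function.Bundles using (mk⇔; Equivalence)
open import Function.Properties.Equivalence using () renaming (sym to ⇔-sym)
open import Relation.Binary.PropositionalEquality using (_≡_; _≢_; refl; sym; trans; cong; subst)
open import Relation.Nullary using (¬_; Dec; yes; no; does; contradiction)
open import Relation.Nullary.Decidable using (_×-dec_; _→-dec_; ¬?; map; decidable-stable)

open Equivalence using (to; from)

indicator : Bool → ℕ
indicator b = if b then 1 else 0

indicator≤1 : ∀ b → indicator b ≤ 1
indicator≤1 true  = ≤-refl
indicator≤1 false = z≤n

indicator-mono : ∀ {b c} → (b ≡ true → c ≡ true) → indicator b ≤ indicator c
indicator-mono {false}         _   = z≤n
indicator-mono {true}  {true}  _   = ≤-refl
indicator-mono {true}  {false} b⇒c = contradiction (b⇒c refl) λ ()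

count-false : ∀ m → count {m} (λ _ → false) ≡ 0
count-false ℕ.zero  = refl
count-false (suc m) = count-false m

count-mono : ∀ {m} {a b : Fin m → Bool} → (∀ i → a i ≡ true → b i ≡ true) → count a ≤ count b
count-mono {ℕ.zero} _   = z≤n
count-mono {suc _}  a⊆b = +-mono-≤ (indicator-mono (a⊆b zero)) (count-mono (a⊆b ∘ suc))

_without_ : ∀ {m} → (Fin m → Bool) → Fin m → Fin m → Bool
(a without k) i = if does (i ≟ k) then false else a i

without-other : ∀ {m} (a : Fin m → Bool) {i k} → i ≢ k → (a without k) i ≡ a i
without-other a {i} {k} i≢k with i ≟ k
... | yes i≡k = contradiction i≡k i≢k
... | no  _   = refl

without-true : ∀ {m} (a : Fin m → Bool) {i k} → (a without k) i ≡ true → i ≢ k × a i ≡ true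
without-true a {i} {k} eq with i ≟ k
without-true a {i} {k} () | yes _
without-true a {i} {k} eq | no i≢k = i≢k , eq

count-without : ∀ {m} (a : Fin m → Bool) k → count a ≡ indicator (a k) + count (a without k)
count-without a zero    = refl
count-without a (suc k) =
  trans (cong (indicator (a zero) +_) (count-without (a ∘ suc) k))
        (x∙yz≈y∙xz (indicator (a zero)) (indicator (a (suc k))) _)

count-without-true : ∀ {m} (a : Fin m → Bool) {k} → a k ≡ true → count a ≡ suc (count (a without k))
count-without-true a {k} ak rewrite count-without a k | ak = refl

count≤suc-count-without : ∀ {m} (a : Fin m → Bool) k → count a ≤ suc (count (a without k))
count≤suc-count-without a k rewrite count-without a k = +-monoˡ-≤ _ (indicator≤1 (a k))

count-two : ∀ {m} {a : Fin m → Bool} {i j} → i ≢ j → a i ≡ true → a j ≡ true → 2 ≤ count a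
count-two {a = a} {i} {j} i≢j ai aj rewrite count-without-true a ai
  | count-without-true (a without i) (trans (without-other a (i≢j ∘ sym)) aj) = s≤s (s≤s z≤n)

atMostOneException-cong : ∀ {m} {P Q : Fin m → Set} → (∀ i → P i ⇔ Q i) →
  AtMostOneException P ⇔ AtMostOneException Q
atMostOneException-cong P⇔Q = mk⇔
  (λ P-once i j ¬Qi ¬Qj → P-once i j (¬Qi ∘ to (P⇔Q i)) (¬Qj ∘ to (P⇔Q j)))
  (λ Q-once i j ¬Pi ¬Pj → Q-once i j (¬Pi ∘ from (P⇔Q i)) (¬Pj ∘ from (P⇔Q j)))

atMostOneException? : ∀ {m} {P : Fin m → Set} → (∀ i → Dec (P i)) → Dec (AtMostOneException P)
atMostOneException? P? = all? λ i → all? λ j → ¬? (P? i) →-dec ¬? (P? j) →-dec i ≟ j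

infix 4 _≈₁_

_≈₁_ : ∀ {m} → (Fin m → Bool) → (Fin m → Bool) → Set
a ≈₁ b = AtMostOneException (λ i → a i ≡ b i)

≈₁-sym : ∀ {m} {a b : Fin m → Bool} → a ≈₁ b → b ≈₁ a
≈₁-sym a≈₁b i j bi≢ai bj≢aj = a≈₁b i j (bi≢ai ∘ sym) (bj≢aj ∘ sym)

without-≈₁ : ∀ {m} (a : Fin m → Bool) {k} → (a without k) ≈₁ a
without-≈₁ a {k} i j i-differs j-differs = trans (differs⇒≡k i-differs) (sym (differs⇒≡k j-differs))
  where
  differs⇒≡k : ∀ {i} → (a without k) i ≢ a i → i ≡ k
  differs⇒≡k {i} differs = decidable-stable (i ≟ k) (differs ∘ without-other a)

count-≈₁ : ∀ {m} {a b : Fin m → Bool} → a ≈₁ b → count a ≤ suc (count b)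
count-≈₁ {a = a} {b} a≈₁b with any? (λ k → ¬? (a k ≟ᵇ b k))
... | yes (k , k-differs) = ≤-trans (count≤suc-count-without a k) (s≤s (count-mono rest⊆b))
  where
  agrees-off-k : ∀ {i} → i ≢ k → a i ≡ b i
  agrees-off-k {i} i≢k = decidable-stable (a i ≟ᵇ b i) λ i-differs → i≢k (a≈₁b i k i-differs k-differs)
  rest⊆b : ∀ i → (a without k) i ≡ true → b i ≡ true
  rest⊆b i eq with without-true a eq
  ... | i≢k , ai = trans (sym (agrees-off-k i≢k)) ai
... | no none = ≤-trans (count-mono a⊆b) (n≤1+n _)
  where
  a⊆b : ∀ i → a i ≡ true → b i ≡ true
  a⊆b i ai = trans (sym (decidable-stable (a i ≟ᵇ b i) λ i-differs → none (i , i-differs))) ai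

count≤1⇒≈₁false : ∀ {m} {a : Fin m → Bool} → count a ≤ 1 → a ≈₁ (λ _ → false)
count≤1⇒≈₁false a≤1 i j ai≢false aj≢false =
  decidable-stable (i ≟ j) λ i≢j → ≤⇒≯ (count-two i≢j (¬-not ai≢false) (¬-not aj≢false)) (s≤s a≤1)

≈₁-with-one-fewer : ∀ {m k} (b : Fin m → Bool) → count b ≤ suc k → ∃ λ a → a ≈₁ b × count a ≤ k
≈₁-with-one-fewer {m} b b≤1+k with any? (λ k → b k ≟ᵇ true)
... | yes (k , bk) = b without k , without-≈₁ b , ≤-pred (subst (_≤ _) (count-without-true b bk) b≤1+k)
... | no none = (λ _ → false) , false≈₁b , subst (_≤ _) (sym (count-false m)) z≤n
  where
  false≈₁b : (λ _ → false) ≈₁ b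
  false≈₁b i _ false≢bi _ = contradiction (sym (¬-not (λ bi → none (i , bi)))) false≢bi

answer⇔required : ∀ {M : Set} {v : Bool} → ((v ≡ true → M) × (M → v ≡ true)) ⇔ (if v then M else ¬ M)
answer⇔required {v = true}  = mk⇔ (λ (yes⇒M , _) → yes⇒M refl) (λ m → (λ _ → m) , λ _ → refl)
answer⇔required {v = false} = mk⇔ (λ (_ , M⇒yes) m → contradiction (M⇒yes m) λ ())
                                   (λ ¬m → (λ ()) , λ m → contradiction m ¬m)

required⇔≡ : ∀ {M : Set} {v w : Bool} → (w ≡ true ⇔ M) → (if v then M else ¬ M) ⇔ (v ≡ w)
required⇔≡ {v = true}  {true}  w⇔M = mk⇔ (λ _ → refl) (λ _ → to w⇔M refl)
required⇔≡ {v = true}  {false} w⇔M = mk⇔ (λ m → contradiction (from w⇔M m) λ ()) λ ()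
required⇔≡ {v = false} {true}  w⇔M = mk⇔ (λ ¬m → contradiction (to w⇔M refl) ¬m) λ ()
required⇔≡ {v = false} {false} w⇔M = mk⇔ (λ _ → refl) (λ _ m → contradiction (from w⇔M m) λ ())

consistent⇔inTStar : ∀ {m n} {F : Family m n} {a T} → Consistent F a T ⇔ InTStar F a T
consistent⇔inTStar = atMostOneException-cong λ _ → answer⇔required

CorrectAnswers : ∀ {m n} → Family m n → Subset n → (Fin m → Bool) → Set
CorrectAnswers F T t = ∀ i → t i ≡ true ⇔ Meets (F i) T

inTStar⇔≈₁ : ∀ {m n} {F : Family m n} {p T t} → CorrectAnswers F T t → InTStar F p T ⇔ p ≈₁ t
inTStar⇔≈₁ t-correct = atMostOneException-cong λ i → required⇔≡ (t-correct i)

≈₁⇒consistent : ∀ {m n} {F : Family m n} {a T t} → CorrectAnswers F T t → a ≈₁ t → Consistent F a T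
≈₁⇒consistent t-correct = from consistent⇔inTStar ∘ from (inTStar⇔≈₁ t-correct)

meets? : ∀ {n} (A T : Subset n) → Dec (Meets A T)
meets? A T = any? λ x → x ∈? A ×-dec x ∈? T

meets?-correct : ∀ {m n} (F : Family m n) T → CorrectAnswers F T (λ i → does (meets? (F i) T))
meets?-correct F T i with meets? (F i) T
... | yes meets = mk⇔ (λ _ → meets) (λ _ → refl)
... | no ¬meets = mk⇔ (λ ()) (λ meets → contradiction meets ¬meets)

empty-correct : ∀ {m n} {F : Family m n} {T} → IsEmpty T → CorrectAnswers F T (λ _ → false)
empty-correct T-empty i = mk⇔ (λ ()) λ (x , _ , x∈T) → contradiction x∈T (T-empty x)

singleton-correct : ∀ {m n} (F : Family m n) x → CorrectAnswers F ⁅ x ⁆ (λ i → lookup (F i) x)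
singleton-correct F x i = mk⇔
  (λ x∈Fi → x , lookup⇒[]= x (F i) x∈Fi , x∈⁅x⁆ x)
  (λ (y , y∈Fi , y∈⁅x⁆) → []=⇒lookup (subst (_∈ F i) (x∈⁅y⁆⇒x≡y x y∈⁅x⁆) y∈Fi))

member⇒yes : ∀ {m n} {F : Family m n} {T t y} → CorrectAnswers F T t → y ∈ T →
  ∀ i → lookup (F i) y ≡ true → t i ≡ true
member⇒yes {F = F} {y = y} t-correct y∈T i y∈Fi = from (t-correct i) (y , lookup⇒[]= y (F i) y∈Fi , y∈T)

inTStar? : ∀ {m n} (F : Family m n) p T → Dec (InTStar F p T)
inTStar? F p T = map (⇔-sym (inTStar⇔≈₁ (meets?-correct F T))) (atMostOneException? λ i → p i ≟ᵇ _)

solves⇒unambiguous : ∀ {m n} {F : Family m n} {a T x} → Solves F →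
  Consistent F a ⊥ → Consistent F a T → x ∈ T → Empty
solves⇒unambiguous {a = a} {T} {x} solves ⊥-consistent T-consistent x∈T with solves a
... | inj₁ (y , y∈consistent) = ∉⊥ (y∈consistent ⊥ ⊥-consistent)
... | inj₂ consistent-empty   = consistent-empty T T-consistent x x∈T

solves⇒condI : ∀ {m n} (F : Family m n) → Solves F → CondI F
solves⇒condI {m} F solves x = decidable-stable (3 ≤? count members) (few-members ∘ ≤-pred ∘ ≰⇒>)
  where
  members : Fin m → Bool
  members i = lookup (F i) x
  -- With x in at most two members, answering YES to all but one of them lies at most once
  -- both for ∅ and for {x}.
  few-members : count members ≤ 2 → Empty
  few-members members≤2 with ≈₁-with-one-fewer members members≤2
  ... | a , a≈₁members , a≤1 = solves⇒unambiguous solves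
    (≈₁⇒consistent (empty-correct λ _ → ∉⊥) (count≤1⇒≈₁false a≤1))
    (≈₁⇒consistent (singleton-correct F x) a≈₁members)
    (x∈⁅x⁆ x)

solves⇒condII : ∀ {m n} (F : Family m n) → Solves F → CondII F
solves⇒condII {m} F solves p 2≤p (T , T∈T*) with solves p
... | inj₁ (x , x∈consistent) = x , λ T′ → x∈consistent T′ ∘ from consistent⇔inTStar
... | inj₂ consistent-empty   = contradiction (s≤s p≤1) (≤⇒≯ 2≤p)
  where
  T-empty : IsEmpty T
  T-empty = consistent-empty T (from consistent⇔inTStar T∈T*)
  p≤1 : count p ≤ 1
  p≤1 = subst (λ c → count p ≤ suc c) (count-false m)
          (count-≈₁ (to (inTStar⇔≈₁ (empty-correct T-empty)) T∈T*))

condI⇒consistent-empty : ∀ {m n} {F : Family m n} {a} → CondI F → count a ≤ 1 →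
  ∀ T → Consistent F a T → IsEmpty T
condI⇒consistent-empty {m} {F = F} {a} condI a≤1 T T-consistent y y∈T = ≤⇒≯ (condI y) (s≤s (begin
  count (λ i → lookup (F i) y) ≤⟨ count-mono (member⇒yes (meets?-correct F T) y∈T) ⟩
  count correct                ≤⟨ count-≈₁ (≈₁-sym a≈₁correct) ⟩
  suc (count a)                ≤⟨ s≤s a≤1 ⟩
  2                            ∎))
  where
  open ≤-Reasoning
  correct : Fin m → Bool
  correct i = does (meets? (F i) T)
  a≈₁correct : a ≈₁ correct
  a≈₁correct = to (inTStar⇔≈₁ (meets?-correct F T)) (to consistent⇔inTStar T-consistent)

condII⇒common-element : ∀ {m n} {F : Family m (suc n)} {a} → CondII F → 2 ≤ count a →
  ∃ λ x → ∀ T → Consistent F a T → x ∈ T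
condII⇒common-element {F = F} {a} condII 2≤a with anySubset? (inTStar? F a)
... | yes T*-nonempty =
  let (x , x∈T*) = condII a 2≤a T*-nonempty in x , λ T → x∈T* T ∘ to consistent⇔inTStar
-- No T is consistent, so any witness will do; this is where n ≥ 1 is needed.
... | no T*-empty = zero , λ T T-consistent → contradiction (T , to consistent⇔inTStar T-consistent) T*-empty

conditions⇒solves : ∀ {m n} (F : Family m (suc n)) → CondI F → CondII F → Solves F
conditions⇒solves F condI condII a with 2 ≤? count a
... | yes 2≤a = inj₁ (condII⇒common-element condII 2≤a)
... | no  2≰a = inj₂ (condI⇒consistent-empty condI (≤-pred (≰⇒> 2≰a)))

lemma2p2 : ∀ (n m : ℕ) → 1 ≤ n → (F : Family m n) →
    Solves F ⇔ (CondI F × CondII F)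
lemma2p2 (suc n) m _ F = mk⇔
  (λ solves → solves⇒condI F solves , solves⇒condII F solves)
  (uncurry (conditions⇒solves F))
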